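{- If $G$ and $H$ are graphs, then $\iota(G\,\Box\, H)\ge \max\{\rho_2(G)\iota(H),\ \rho_2(H)\iota(G)\}$.
   Context: All graphs are finite and simple; $\Box$ is the Cartesian product. A $2$-packing is a set of vertices whose closed neighborhoods are pairwise disjoint; $\rho_2(G)$ is the maximum size of a $2$-packing. A set $A$ of vertices is isolating if no two vertices outside the closed neighborhood $N[A]$ are adjacent; $\iota$ is the minimum size of an isolating set. -}

module Defs where

open import Data.Nat using (ℕ; _*_; _≤_)
open import Data.Fin using (Fin; remQuot)
open import Data.Fin.Subset using (Subset; _∈_; _∉_; ∣_∣)
open import Data.Product using (Σ; ∃; _×_; _,_; proj₁; proj₂)
open import Data.Sum using (_⊎_)
open import Data.Empty using (⊥)
open import Relation.Nullary using (¬_)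
open import Relation.Binary.PropositionalEquality using (_≡_)

record Graph : Set₁ where
  field
    n   : ℕ
    Adj : Fin n → Fin n → Set

open Graph public

IsSimple : Graph → Set
IsSimple G = (∀ u v → Adj G u v → Adj G v u) × (∀ u → ¬ Adj G u u)

InN : (G : Graph) → Fin (n G) → Fin (n G) → Set
InN G u v = u ≡ v ⊎ Adj G v u

InNSet : (G : Graph) → Fin (n G) → Subset (n G) → Set
InNSet G u A = ∃ λ a → a ∈ A × InN G u a

Is2Packing : (G : Graph) → Subset (n G) → Set
Is2Packing G P = ∀ u v → u ∈ P → v ∈ P → ¬ (u ≡ v) →
  ∀ w → InN G w u → InN G w v → ⊥

IsIsolating : (G : Graph) → Subset (n G) → Set
IsIsolating G A = ∀ u v → ¬ InNSet G u A → ¬ InNSet G v A → ¬ Adj G u v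

IsRho2 : Graph → ℕ → Set
IsRho2 G k = (∃ λ P → Is2Packing G P × ∣ P ∣ ≡ k)
           × (∀ P → Is2Packing G P → ∣ P ∣ ≤ k)

IsIota : Graph → ℕ → Set
IsIota G k = (∃ λ A → IsIsolating G A × ∣ A ∣ ≡ k)
           × (∀ A → IsIsolating G A → k ≤ ∣ A ∣)

-- Cartesian product G □ H on Fin (n G * n H); vertex x corresponds to
-- remQuot x = (g , h).
_□_ : Graph → Graph → Graph
G □ H = record
  { n   = n G * n H
  ; Adj = λ x y →
      let gx = proj₁ (remQuot {n G} (n H) x) ; hx = proj₂ (remQuot {n G} (n H) x)
          gy = proj₁ (remQuot {n G} (n H) y) ; hy = proj₂ (remQuot {n G} (n H) y)
      in (gx ≡ gy × Adj H hx hy) ⊎ (hx ≡ hy × Adj G gx gy)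
  }

module Submission where

-- Fix an isolating set A of G □ H and a 2-packing P of G.  For p ∈ P, the
-- H-coordinates of those vertices of A whose G-coordinate lies in N[p] form an
-- isolating set of H (every edge of the H-layer over p is dominated through
-- N[p]), so there are at least ι(H) of them.  The sets N[p], p ∈ P, are
-- disjoint, so these ∣P∣ · ι(H) witnesses in A are distinct.  Symmetrically for
-- a 2-packing of H.

open import Defs
open import Data.Nat using (ℕ; zero; suc; _*_; _≤_; _⊔_)
open import Data.Nat.Properties using (⊔-lub; _≤?_)
open import Data.Bool using (true; false)
open import Data.Fin using (Fin; zero; suc; remQuot; combine; inject≤; _≟_)
open import Data.Fin.Properties
  using (suc-injective; injective⇒≤; any?; inject≤-injective; remQuot-combine; combine-remQuot)
open import Data.Fin.Subset using (Subset; _∈_; ∣_∣)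
open import Data.Fin.Subset.Properties using (_∈?_)
open import Data.Vec using ([]; _∷_; here; there)
open import Data.Product using (∃; _×_; _,_; proj₁; proj₂; uncurry)
open import Data.Sum as Sum using (_⊎_; inj₁; inj₂)
open import Data.Empty using (⊥-elim)
open import Relation.Nullary using (¬_; Dec; yes; no; does; _×-dec_; _⊎-dec_)
open import Relation.Nullary.Decidable using (decidable-stable; ¬¬-excluded-middle)
open import Relation.Unary using (Pred; Decidable)
open import Relation.Binary.PropositionalEquality
  using (_≡_; refl; sym; trans; cong; subst; subst₂)

enum : ∀ {n} (S : Subset n) → Fin ∣ S ∣ → Fin n
enum (true ∷ S) zero = zero
enum (true ∷ S) (suc i) = suc (enum S i)
enum (false ∷ S) i = suc (enum S i)

enum-∈ : ∀ {n} (S : Subset n) i → enum S i ∈ S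
enum-∈ (true ∷ S) zero = here
enum-∈ (true ∷ S) (suc i) = there (enum-∈ S i)
enum-∈ (false ∷ S) i = there (enum-∈ S i)

enum-injective : ∀ {n} (S : Subset n) {i j} → enum S i ≡ enum S j → i ≡ j
enum-injective (true ∷ S) {zero} {zero} _ = refl
enum-injective (true ∷ S) {suc i} {suc j} e = cong suc (enum-injective S (suc-injective e))
enum-injective (false ∷ S) e = enum-injective S (suc-injective e)

rank : ∀ {n} (S : Subset n) {x} → x ∈ S → Fin ∣ S ∣
rank (true ∷ S) here = zero
rank (true ∷ S) (there x∈S) = suc (rank S x∈S)
rank (false ∷ S) (there x∈S) = rank S x∈S

rank-injective : ∀ {n} (S : Subset n) {x y} (x∈S : x ∈ S) (y∈S : y ∈ S) →
                 rank S x∈S ≡ rank S y∈S → x ≡ y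
rank-injective (true ∷ S) here here _ = refl
rank-injective (true ∷ S) (there x∈S) (there y∈S) e =
  cong suc (rank-injective S x∈S y∈S (suc-injective e))
rank-injective (false ∷ S) (there x∈S) (there y∈S) e =
  cong suc (rank-injective S x∈S y∈S e)

injective⇒≤∣∣ : ∀ {k n} (S : Subset n) (f : Fin k → Fin n) → (∀ i → f i ∈ S) →
                (∀ {i j} → f i ≡ f j → i ≡ j) → k ≤ ∣ S ∣
injective⇒≤∣∣ S f f∈S f-inj =
  injective⇒≤ (λ {i} {j} e → f-inj (rank-injective S (f∈S i) (f∈S j) e))

injective₂⇒*≤∣∣ : ∀ {a b n} (S : Subset n) (f : Fin a → Fin b → Fin n) →
                  (∀ i j → f i j ∈ S) →
                  (∀ {i j k l} → f i j ≡ f k l → (i , j) ≡ (k , l)) → a * b ≤ ∣ S ∣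
injective₂⇒*≤∣∣ {a} {b} S f f∈S f-inj =
  injective⇒≤∣∣ S (λ x → uncurry f (remQuot b x)) (λ x → uncurry f∈S (remQuot b x)) injective
  where
  injective : ∀ {x y} → uncurry f (remQuot b x) ≡ uncurry f (remQuot b y) → x ≡ y
  injective {x} {y} e = trans (sym (combine-remQuot {a} b x))
    (trans (cong (uncurry combine) (f-inj e)) (combine-remQuot {a} b y))

subsetOf : ∀ {n ℓ} {P : Pred (Fin n) ℓ} → Decidable P → Subset n
subsetOf {zero} _ = []
subsetOf {suc n} P? = does (P? zero) ∷ subsetOf (λ x → P? (suc x))

∈-subsetOf⁺ : ∀ {n ℓ} {P : Pred (Fin n) ℓ} (P? : Decidable P) {x} → P x → x ∈ subsetOf P?
∈-subsetOf⁺ P? {zero} p with P? zero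
... | yes _ = here
... | no ¬p = ⊥-elim (¬p p)
∈-subsetOf⁺ P? {suc x} p = there (∈-subsetOf⁺ (λ y → P? (suc y)) p)

∈-subsetOf⁻ : ∀ {n ℓ} {P : Pred (Fin n) ℓ} (P? : Decidable P) {x} → x ∈ subsetOf P? → P x
∈-subsetOf⁻ P? {zero} x∈P with P? zero | x∈P
... | yes p | _ = p
... | no _ | ()
∈-subsetOf⁻ P? {suc x} (there x∈P) = ∈-subsetOf⁻ (λ y → P? (suc y)) x∈P

Is2Packing-≡ : ∀ (G : Graph) {P p q w} → Is2Packing G P → p ∈ P → q ∈ P →
               InN G w p → InN G w q → p ≡ q
Is2Packing-≡ G {p = p} {q} {w} pack p∈P q∈P w∈N[p] w∈N[q] with p ≟ q
... | yes p≡q = p≡q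
... | no p≢q = ⊥-elim (pack p q p∈P q∈P p≢q w w∈N[p] w∈N[q])

record CartesianProduct (G H K : Graph) : Set where
  field
    fst       : Fin (n K) → Fin (n G)
    snd       : Fin (n K) → Fin (n H)
    pair      : Fin (n G) → Fin (n H) → Fin (n K)
    fst-pair  : ∀ g h → fst (pair g h) ≡ g
    snd-pair  : ∀ g h → snd (pair g h) ≡ h
    pair-adjˡ : ∀ {g g′} h → Adj G g g′ → Adj K (pair g h) (pair g′ h)
    pair-adjʳ : ∀ g {h h′} → Adj H h h′ → Adj K (pair g h) (pair g h′)
    adj-cases : ∀ {x y} → Adj K x y →
      (fst x ≡ fst y × Adj H (snd x) (snd y)) ⊎ (snd x ≡ snd y × Adj G (fst x) (fst y))

□-cartesianProduct : ∀ G H → CartesianProduct G H (G □ H)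
□-cartesianProduct G H = record
  { fst = λ x → proj₁ (remQuot {n G} (n H) x)
  ; snd = λ x → proj₂ (remQuot {n G} (n H) x)
  ; pair = combine
  ; fst-pair = λ g h → cong proj₁ (remQuot-combine g h)
  ; snd-pair = λ g h → cong proj₂ (remQuot-combine g h)
  ; pair-adjˡ = λ {g} {g′} h g~g′ →
      subst₂ Adjᶜ (sym (remQuot-combine g h)) (sym (remQuot-combine g′ h)) (inj₂ (refl , g~g′))
  ; pair-adjʳ = λ g {h} {h′} h~h′ →
      subst₂ Adjᶜ (sym (remQuot-combine g h)) (sym (remQuot-combine g h′)) (inj₁ (refl , h~h′))
  ; adj-cases = λ x~y → x~y
  }
  where
  -- Adj (G □ H) x y unfolds to Adjᶜ (remQuot x) (remQuot y).
  Adjᶜ : Fin (n G) × Fin (n H) → Fin (n G) × Fin (n H) → Set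
  Adjᶜ (g , h) (g′ , h′) = (g ≡ g′ × Adj H h h′) ⊎ (h ≡ h′ × Adj G g g′)

CartesianProduct-swap : ∀ {G H K} → CartesianProduct G H K → CartesianProduct H G K
CartesianProduct-swap K-prod = record
  { fst = snd
  ; snd = fst
  ; pair = λ h g → pair g h
  ; fst-pair = λ h g → snd-pair g h
  ; snd-pair = λ h g → fst-pair g h
  ; pair-adjˡ = λ g h~h′ → pair-adjʳ g h~h′
  ; pair-adjʳ = λ h g~g′ → pair-adjˡ h g~g′
  ; adj-cases = λ x~y → Sum.swap (adj-cases x~y)
  }
  where open CartesianProduct K-prod

module _ {G H K : Graph} (K-prod : CartesianProduct G H K)
         (G-sym : ∀ u v → Adj G u v → Adj G v u) (G-dec : ∀ u v → Dec (Adj G u v)) where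
  open CartesianProduct K-prod

  Above : Subset (n K) → Fin (n G) → Fin (n H) → Fin (n K) → Set
  Above A p h x = x ∈ A × InN G (fst x) p × snd x ≡ h

  above? : ∀ A p h → Decidable (Above A p h)
  above? A p h x = (x ∈? A) ×-dec ((fst x ≟ p) ⊎-dec G-dec p (fst x)) ×-dec (snd x ≟ h)

  shadow : Subset (n K) → Fin (n G) → Subset (n H)
  shadow A p = subsetOf (λ h → any? (above? A p h))

  ∈-shadow⁺ : ∀ {A p h} x → Above A p h x → h ∈ shadow A p
  ∈-shadow⁺ x above = ∈-subsetOf⁺ _ (x , above)

  ∈-shadow⁻ : ∀ {A p h} → h ∈ shadow A p → ∃ (Above A p h)
  ∈-shadow⁻ = ∈-subsetOf⁻ _

  InNSet-pair⇒InNSet-shadow : ∀ {A} p h → InNSet K (pair p h) A → InNSet H h (shadow A p)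
  InNSet-pair⇒InNSet-shadow p h (a , a∈A , inj₁ pair≡a) =
    h , ∈-shadow⁺ a (a∈A , inj₁ fst-a≡p , snd-a≡h) , inj₁ refl
    where
    fst-a≡p = trans (cong fst (sym pair≡a)) (fst-pair p h)
    snd-a≡h = trans (cong snd (sym pair≡a)) (snd-pair p h)
  InNSet-pair⇒InNSet-shadow p h (a , a∈A , inj₂ a~pair) with adj-cases a~pair
  ... | inj₁ (fst-a≡ , snd-a~) =
    snd a , ∈-shadow⁺ a (a∈A , inj₁ (trans fst-a≡ (fst-pair p h)) , refl) ,
    inj₂ (subst (Adj H (snd a)) (snd-pair p h) snd-a~)
  ... | inj₂ (snd-a≡ , fst-a~) =
    h , ∈-shadow⁺ a (a∈A , inj₂ (G-sym _ _ (subst (Adj G (fst a)) (fst-pair p h) fst-a~)) ,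
                     trans snd-a≡ (snd-pair p h)) ,
    inj₁ refl

  shadow-isolating : ∀ {A} → IsIsolating K A → ∀ p → IsIsolating H (shadow A p)
  shadow-isolating isoA p h h′ h∉ h′∉ h~h′ =
    isoA (pair p h) (pair p h′) (λ h∈ → h∉ (InNSet-pair⇒InNSet-shadow p h h∈))
      (λ h′∈ → h′∉ (InNSet-pair⇒InNSet-shadow p h′ h′∈)) (pair-adjʳ p h~h′)

  packing-shadows-bound : ∀ {A P i} → Is2Packing G P → (∀ p → i ≤ ∣ shadow A p ∣) →
                          ∣ P ∣ * i ≤ ∣ A ∣
  packing-shadows-bound {A} {P} {i} pack i≤∣shadow∣ = injective₂⇒*≤∣∣ A lift lift-∈ lift-injective
    where
    point : Fin ∣ P ∣ → Fin i → Fin (n H)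
    point k j = enum (shadow A (enum P k)) (inject≤ j (i≤∣shadow∣ (enum P k)))

    lifted : ∀ k j → ∃ (Above A (enum P k) (point k j))
    lifted k j = ∈-shadow⁻ (enum-∈ _ _)

    lift : Fin ∣ P ∣ → Fin i → Fin (n K)
    lift k j = proj₁ (lifted k j)

    lift-∈ : ∀ k j → lift k j ∈ A
    lift-∈ k j = proj₁ (proj₂ (lifted k j))

    lift-near : ∀ k j → InN G (fst (lift k j)) (enum P k)
    lift-near k j = proj₁ (proj₂ (proj₂ (lifted k j)))

    lift-snd : ∀ k j → snd (lift k j) ≡ point k j
    lift-snd k j = proj₂ (proj₂ (proj₂ (lifted k j)))

    lift-injective : ∀ {k j k′ j′} → lift k j ≡ lift k′ j′ → (k , j) ≡ (k′ , j′)
    lift-injective {k} {j} {k′} {j′} e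
      with refl ← enum-injective P (Is2Packing-≡ G pack (enum-∈ P k) (enum-∈ P k′)
                    (lift-near k j) (subst (λ x → InN G (fst x) (enum P k′)) (sym e) (lift-near k′ j′)))
      = cong (k ,_) (inject≤-injective _ _ j j′ (enum-injective (shadow A (enum P k)) point≡))
      where
      point≡ : point k j ≡ point k j′
      point≡ = trans (sym (lift-snd k j)) (trans (cong snd e) (lift-snd k j′))

  ρ₂*ι≤ι : ∀ {r i k} → IsRho2 G r → IsIota H i → IsIota K k → r * i ≤ k
  ρ₂*ι≤ι ((P , pack , refl) , _) (_ , ι-minimal) ((A , isoA , refl) , _) =
    packing-shadows-bound pack (λ p → ι-minimal (shadow A p) (shadow-isolating isoA p))

¬¬-∀-Fin : ∀ {n} {P : Fin n → Set} → (∀ i → ¬ ¬ P i) → ¬ ¬ (∀ i → P i)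
¬¬-∀-Fin {zero} _ k = k (λ ())
¬¬-∀-Fin {suc n} {P} ¬¬P k =
  ¬¬P zero λ P0 → ¬¬-∀-Fin (λ i → ¬¬P (suc i)) λ Psuc → k λ { zero → P0 ; (suc i) → Psuc i }

¬¬-Adj-decidable : ∀ G → ¬ ¬ (∀ u v → Dec (Adj G u v))
¬¬-Adj-decidable G = ¬¬-∀-Fin λ u → ¬¬-∀-Fin λ v → ¬¬-excluded-middle

-- Adjacency need not be decidable, but the goal is, so we may assume it is.
theorem3p6 : (G H : Graph) → IsSimple G → IsSimple H →
    (rG rH iG iH iGH : ℕ) →
    IsRho2 G rG → IsRho2 H rH → IsIota G iG → IsIota H iH →
    IsIota (G □ H) iGH →
    (rG * iH) ⊔ (rH * iG) ≤ iGH
theorem3p6 G H (G-sym , _) (H-sym , _) rG rH iG iH iGH ρG ρH ιG ιH ιGH =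
  decidable-stable (_ ≤? _) λ ¬goal →
  ¬¬-Adj-decidable G λ G-dec →
  ¬¬-Adj-decidable H λ H-dec →
  ¬goal (⊔-lub (ρ₂*ι≤ι GH G-sym G-dec ρG ιH ιGH)
               (ρ₂*ι≤ι (CartesianProduct-swap GH) H-sym H-dec ρH ιG ιGH))
  where
  GH = □-cartesianProduct G H
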